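{- Let $G$ be a finite group with a chain of subgroups $\{e\}=H_0\subsetneq H=H_1\subsetneq H_2\subsetneq\dots\subsetneq H_n=G$ such that $[H_i:H_{i-1}]=m$ for all $i=1,\dots,n$ (a geometric chain), with $H\ne\{e\}$. Then $(G,d_{\mathcal{C}})$ is isometric to $(H^n,d_{RT})$.
   Context: The chain metric of the chain $\mathcal{C}$ is $d_{\mathcal{C}}(x,y)=i$ if $xy^{ -1}\in H_i\setminus H_{i-1}$, $i=0,\dots,n$, with $H_{ -1}=\varnothing$. The Rosenbloom–Tsfasman metric on $H^n$ is $d_{RT}(x,y)=\max\{1\le i\le n: x_i\ne y_i\}$ for $x\ne y$ and $d_{RT}(x,x)=0$. An isometry is a distance-preserving bijection. -}

module Defs where

open import Level using (Level; _⊔_)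
open import Algebra.Bundles using (Group)
open import Data.Nat using (ℕ; zero; suc; _≤_; _<_)
open import Data.Fin using (Fin; toℕ)
open import Data.Product using (Σ; ∃; _×_; _,_)
open import Data.Sum using (_⊎_)
open import Relation.Binary.PropositionalEquality using (_≡_)
open import Relation.Nullary using (¬_)

module _ {c ℓ : Level} (G : Group c ℓ) where
  open Group G

  record IsFiniteGroup : Set (c ⊔ ℓ) where
    field
      size       : ℕ
      enum       : Fin size → Carrier
      enum-inj   : ∀ i j → enum i ≈ enum j → i ≡ j
      enum-surj  : ∀ x → ∃ λ i → enum i ≈ x

  record Subgroup (p : Level) : Set (c ⊔ ℓ ⊔ Level.suc p) where
    field
      Mem     : Carrier → Set p
      resp    : ∀ {x y} → x ≈ y → Mem x → Mem y
      has-ε   : Mem ε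
      ∙-closed : ∀ {x y} → Mem x → Mem y → Mem (x ∙ y)
      ⁻¹-closed : ∀ {x} → Mem x → Mem (x ⁻¹)
  open Subgroup public

  _⊆_ : ∀ {p q} → Subgroup p → Subgroup q → Set (c ⊔ p ⊔ q)
  A ⊆ B = ∀ x → Mem A x → Mem B x

  _⊊_ : ∀ {p q} → Subgroup p → Subgroup q → Set (c ⊔ p ⊔ q)
  A ⊊ B = A ⊆ B × ∃ λ x → Mem B x × ¬ Mem A x

  IsTrivial : ∀ {p} → Subgroup p → Set (c ⊔ ℓ ⊔ p)
  IsTrivial A = ∀ x → Mem A x → x ≈ ε

  IsWhole : ∀ {p} → Subgroup p → Set (c ⊔ p)
  IsWhole A = ∀ x → Mem A x

  -- [K : A] = m : there is a family of m left-coset representatives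
  -- g_1..g_m ∈ K such that the cosets g_j A are pairwise distinct and cover K.
  HasIndex : ∀ {p q} → (A : Subgroup p) → (K : Subgroup q) → ℕ → Set (c ⊔ p ⊔ q)
  HasIndex A K m =
    Σ (Fin m → Carrier) λ g →
        (∀ j → Mem K (g j))
      × (∀ x → Mem K x → ∃ λ j → Mem A (g j ⁻¹ ∙ x))
      × (∀ j k → Mem A (g j ⁻¹ ∙ g k) → j ≡ k)

  -- A geometric chain {e} = H_0 ⊊ H_1 ⊊ ... ⊊ H_n = G with all indices m.
  -- (H is indexed by ℕ; only H_0, ..., H_n are relevant.)
  record GeometricChain {p} (n m : ℕ) (H : ℕ → Subgroup p) : Set (c ⊔ ℓ ⊔ p) where
    field
      bottom  : IsTrivial (H 0)
      top     : IsWhole (H n)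
      strict  : ∀ i → suc i ≤ n → H i ⊊ H (suc i)
      index   : ∀ i → suc i ≤ n → HasIndex (H i) (H (suc i)) m

  -- The chain metric, as a relation: d_C(x,y) = i  iff  i ≤ n and
  -- x y⁻¹ ∈ H_i \ H_{i-1}  (with H_{-1} = ∅).
  ChainDist : ∀ {p} (n : ℕ) (H : ℕ → Subgroup p) → Carrier → Carrier → ℕ → Set p
  ChainDist n H x y zero    = Mem (H 0) (x ∙ y ⁻¹)
  ChainDist n H x y (suc i) = suc i ≤ n × Mem (H (suc i)) (x ∙ y ⁻¹) × ¬ Mem (H i) (x ∙ y ⁻¹)

  record Elem {p} (A : Subgroup p) : Set (c ⊔ p) where
    constructor ⟨_,_⟩
    field
      val : Carrier
      mem : Mem A val

  _≈ᴱ_ : ∀ {p} {A : Subgroup p} → Elem A → Elem A → Set ℓ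
  ⟨ a , _ ⟩ ≈ᴱ ⟨ b , _ ⟩ = a ≈ b

  _≈ⁿ_ : ∀ {p} {A : Subgroup p} {n : ℕ} → (Fin n → Elem A) → (Fin n → Elem A) → Set ℓ
  u ≈ⁿ v = ∀ j → u j ≈ᴱ v j

  -- Rosenbloom–Tsfasman metric on A^n (coordinates 1..n ↔ Fin n entries 0..n-1):
  -- d_RT(u,v) = i  iff  u_j = v_j for all coordinates j > i, and either
  -- i = 0 or coordinate i differs.
  RTDist : ∀ {p} {A : Subgroup p} {n : ℕ} → (Fin n → Elem A) → (Fin n → Elem A) → ℕ → Set ℓ
  RTDist {n = n} u v i =
      (∀ (j : Fin n) → i ≤ toℕ j → u j ≈ᴱ v j)
    × (i ≡ 0 ⊎ Σ (Fin n) λ k → suc (toℕ k) ≡ i × ¬ (u k ≈ᴱ v k))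

  record ChainRTIsometry {p} (n : ℕ) (H : ℕ → Subgroup p) (A : Subgroup p) : Set (c ⊔ ℓ ⊔ p) where
    field
      to        : Carrier → (Fin n → Elem A)
      to-cong   : ∀ {x y} → x ≈ y → to x ≈ⁿ to y
      to-inj    : ∀ {x y} → to x ≈ⁿ to y → x ≈ y
      to-surj   : ∀ u → ∃ λ x → to x ≈ⁿ u
      isometric : ∀ x y i → (ChainDist n H x y i → RTDist {A = A} (to x) (to y) i)
                          × (RTDist {A = A} (to x) (to y) i → ChainDist n H x y i)

-- Choosing left coset representatives r_k(0), …, r_k(m-1) of H_k in H_{k+1} writes every
-- element of H_k uniquely as a word r_{k-1}(d_{k-1}) ⋯ r_0(d_0) with digits d_j ∈ Fin m.
-- Two words lie in the same left coset of H_i exactly when their digits agree from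
-- position i on: going down from the top, the factor below position k lies in H_k, so the
-- top digits must agree modulo H_k, hence be equal. As H_0 = {e}, r_0 is a bijection from
-- Fin m onto H = H_1, and x ↦ (r_0(d_j(x⁻¹)))_j is the isometry.
module Submission where

open import Defs
open import Level using (Level)
open import Algebra.Bundles using (Group)
open import Data.Nat using (ℕ; zero; suc; _≤_; _<_; _≤′_; ≤′-refl; ≤′-step; z≤n; s≤s)
open import Data.Nat.Properties
  using (≤-refl; ≤-reflexive; ≤-trans; <⇒≤; ≤⇒≯; <-irrefl; m<n⇒m<1+n; m<1+n⇒m<n∨m≡n;
         m≤n⇒m<n∨m≡n; z≤′n; ≤⇒≤′; ≤′⇒≤)
open import Data.Fin using (Fin; toℕ; fromℕ<)
open import Data.Fin.Properties using (toℕ<n; toℕ-fromℕ<; toℕ-injective)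
open import Data.Vec.Functional using (updateAt)
open import Data.Vec.Functional.Properties using (updateAt-updates; updateAt-minimal)
open import Data.Product using (∃; _,_; proj₁; proj₂)
open import Data.Sum using (inj₁; inj₂)
open import Data.Empty using (⊥-elim)
open import Function using (const; _∘_)
open import Relation.Binary.Core using (Rel)
open import Relation.Nullary using (¬_)
open import Relation.Binary.PropositionalEquality as ≡ using (_≡_; _≢_)
import Algebra.Properties.Group as GroupProperties
import Relation.Binary.Reasoning.Setoid as SetoidReasoning

module _ {c ℓ : Level} (G : Group c ℓ) where
  open Group G
  open GroupProperties G
  open SetoidReasoning setoid

  \\-∙-∙ : ∀ a s b s' → (a ∙ s) \\ (b ∙ s') ≈ s \\ ((a \\ b) ∙ s')
  \\-∙-∙ a s b s' = begin
    (a ∙ s) ⁻¹ ∙ (b ∙ s')       ≈⟨ ∙-congʳ (⁻¹-anti-homo-∙ a s) ⟩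
    s ⁻¹ ∙ a ⁻¹ ∙ (b ∙ s')      ≈⟨ assoc _ _ _ ⟩
    s ⁻¹ ∙ (a ⁻¹ ∙ (b ∙ s'))    ≈⟨ ∙-congˡ (assoc _ _ _) ⟨
    s ⁻¹ ∙ (a ⁻¹ ∙ b ∙ s')      ∎

  \\-∙-cancelˡ : ∀ {a a'} → a ≈ a' → ∀ s s' → (a ∙ s) \\ (a' ∙ s') ≈ s \\ s'
  \\-∙-cancelˡ {a} {a'} a≈a' s s' = begin
    (a ∙ s) \\ (a' ∙ s')        ≈⟨ \\-∙-∙ a s a' s' ⟩
    s \\ (a ⁻¹ ∙ a' ∙ s')       ≈⟨ ∙-congˡ (∙-congʳ (∙-congˡ (sym a≈a'))) ⟩
    s \\ (a ⁻¹ ∙ a ∙ s')        ≈⟨ ∙-congˡ (∙-congʳ (inverseˡ a)) ⟩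
    s \\ (ε ∙ s')               ≈⟨ ∙-congˡ (identityˡ s') ⟩
    s \\ s'                     ∎

  ∙⁻¹≈⁻¹\\⁻¹ : ∀ x y → x ∙ y ⁻¹ ≈ x ⁻¹ \\ y ⁻¹
  ∙⁻¹≈⁻¹\\⁻¹ x y = ∙-congʳ (sym (⁻¹-involutive x))

  SameCoset : ∀ {p} → Subgroup G p → Carrier → Carrier → Set p
  SameCoset K a b = Mem K (a \\ b)

  module _ {p} (K : Subgroup G p) where

    sameCoset-resp : ∀ {a a' b b'} → a ≈ a' → b ≈ b' → SameCoset K a b → SameCoset K a' b'
    sameCoset-resp a≈a' b≈b' = resp K (\\-cong₂ a≈a' b≈b')

    ≈⇒sameCoset : ∀ {a b} → a ≈ b → SameCoset K a b
    ≈⇒sameCoset {a} a≈b = resp K (trans (sym (inverseˡ a)) (∙-congˡ a≈b)) (has-ε K)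

    ∈⇒sameCoset : ∀ {a b} → Mem K a → Mem K b → SameCoset K a b
    ∈⇒sameCoset a∈K b∈K = ∙-closed K (⁻¹-closed K a∈K) b∈K

    sameCoset-∙-∈ʳ : ∀ {a s b s'} → Mem K s → Mem K s' →
                     SameCoset K (a ∙ s) (b ∙ s') → SameCoset K a b
    sameCoset-∙-∈ʳ {a} {s} {b} {s'} s∈K s'∈K as~bs' =
      resp K unconjugate (∙-closed K (∙-closed K s∈K as~bs') (⁻¹-closed K s'∈K))
      where
      unconjugate : s ∙ ((a ∙ s) \\ (b ∙ s')) ∙ s' ⁻¹ ≈ a \\ b
      unconjugate = begin
        s ∙ ((a ∙ s) \\ (b ∙ s')) ∙ s' ⁻¹    ≈⟨ ∙-congʳ (∙-congˡ (\\-∙-∙ a s b s')) ⟩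
        s ∙ (s \\ ((a \\ b) ∙ s')) ∙ s' ⁻¹   ≈⟨ ∙-congʳ (\\-leftDividesˡ s _) ⟩
        (a \\ b) ∙ s' ∙ s' ⁻¹                ≈⟨ //-rightDividesʳ s' (a \\ b) ⟩
        a \\ b                               ∎

    sameCoset-trivial⇒≈ : IsTrivial G K → ∀ {a b} → SameCoset K a b → a ≈ b
    sameCoset-trivial⇒≈ K≈ε {a} {b} a~b =
      ⁻¹-injective (inverseˡ-unique (a ⁻¹) b (K≈ε _ a~b))

AgreeFrom : ∀ {a r} {A : Set a} {n : ℕ} → Rel A r → ℕ → (Fin n → A) → (Fin n → A) → Set r
AgreeFrom _∼_ i u v = ∀ j → i ≤ toℕ j → u j ∼ v j

AgreeOn : ∀ {a} {A : Set a} {n : ℕ} → ℕ → ℕ → (Fin n → A) → (Fin n → A) → Set a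
AgreeOn i k u v = ∀ j → i ≤ toℕ j → toℕ j < k → u j ≡ v j

module _ {a} {A : Set a} {n : ℕ} {i k : ℕ} {u v : Fin n → A} where

  agreeOn-shrink : AgreeOn i (suc k) u v → AgreeOn i k u v
  agreeOn-shrink agree j i≤j j<k = agree j i≤j (m<n⇒m<1+n j<k)

  agreeOn-top : i ≤ k → (k<n : k < n) → AgreeOn i (suc k) u v → u (fromℕ< k<n) ≡ v (fromℕ< k<n)
  agreeOn-top i≤k k<n agree =
    agree (fromℕ< k<n) (≤-trans i≤k (≤-reflexive (≡.sym top≡k))) (s≤s (≤-reflexive top≡k))
    where top≡k = toℕ-fromℕ< k<n

  agreeOn-extend : (k<n : k < n) → u (fromℕ< k<n) ≡ v (fromℕ< k<n) →
                   AgreeOn i k u v → AgreeOn i (suc k) u v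
  agreeOn-extend k<n top agree j i≤j j≤k with m<1+n⇒m<n∨m≡n j≤k
  ... | inj₁ j<k = agree j i≤j j<k
  ... | inj₂ j≡k rewrite toℕ-injective (≡.trans j≡k (≡.sym (toℕ-fromℕ< k<n))) = top

agreeOn⇒agreeFrom : ∀ {a} {A : Set a} {n i : ℕ} {u v : Fin n → A} →
                    AgreeOn i n u v → AgreeFrom _≡_ i u v
agreeOn⇒agreeFrom agree j i≤j = agree j i≤j (toℕ<n j)

agreeFrom⇒agreeOn : ∀ {a} {A : Set a} {n i : ℕ} {u v : Fin n → A} →
                    AgreeFrom _≡_ i u v → AgreeOn i n u v
agreeFrom⇒agreeOn agree j i≤j _ = agree j i≤j

agreeFrom-extend : ∀ {a r} {A : Set a} {n : ℕ} {_∼_ : Rel A r} {u v : Fin n → A} (k : Fin n) →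
                   u k ∼ v k → AgreeFrom _∼_ (suc (toℕ k)) u v → AgreeFrom _∼_ (toℕ k) u v
agreeFrom-extend k uk∼vk agree j k≤j with m≤n⇒m<n∨m≡n k≤j
... | inj₁ k<j = agree j k<j
... | inj₂ k≡j rewrite toℕ-injective k≡j = uk∼vk

module _ {c ℓ p : Level} (G : Group c ℓ) {n m : ℕ} {H : ℕ → Subgroup G p}
         (chain : GeometricChain G n m H) where
  open Group G
  open GroupProperties G
  open GeometricChain chain
  open SetoidReasoning setoid

  H-mono : ∀ {i k} → i ≤′ k → k ≤ n → ∀ x → Mem (H i) x → Mem (H k) x
  H-mono ≤′-refl        _   _ x∈H = x∈H
  H-mono (≤′-step i≤k) k<n x x∈H = proj₁ (strict _ k<n) x (H-mono i≤k (<⇒≤ k<n) x x∈H)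

  rep : ∀ k → k < n → Fin m → Carrier
  rep k k<n = proj₁ (index k k<n)

  rep∈H : ∀ k (k<n : k < n) a → Mem (H (suc k)) (rep k k<n a)
  rep∈H k k<n = proj₁ (proj₂ (index k k<n))

  rep-covers : ∀ k (k<n : k < n) x → Mem (H (suc k)) x →
               ∃ λ a → SameCoset G (H k) (rep k k<n a) x
  rep-covers k k<n = proj₁ (proj₂ (proj₂ (index k k<n)))

  rep-injective : ∀ k (k<n : k < n) {a b} →
                  SameCoset G (H k) (rep k k<n a) (rep k k<n b) → a ≡ b
  rep-injective k k<n = proj₂ (proj₂ (proj₂ (index k k<n))) _ _

  Digits : Set
  Digits = Fin n → Fin m

  word : ∀ k → k ≤ n → Digits → Carrier
  word zero    _   d = ε
  word (suc k) k<n d = rep k k<n (d (fromℕ< k<n)) ∙ word k (<⇒≤ k<n) d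

  word∈H : ∀ k (k≤n : k ≤ n) d → Mem (H k) (word k k≤n d)
  word∈H zero    _   _ = has-ε (H 0)
  word∈H (suc k) k<n d =
    ∙-closed (H (suc k)) (rep∈H k k<n _) (H-mono (≤′-step ≤′-refl) k<n _ (word∈H k _ d))

  agreeOn⇒sameCoset : ∀ {i k} → i ≤′ k → (k≤n : k ≤ n) → ∀ {d d'} →
                      AgreeOn i k d d' → SameCoset G (H i) (word k k≤n d) (word k k≤n d')
  agreeOn⇒sameCoset ≤′-refl k≤n _ = ∈⇒sameCoset G (H _) (word∈H _ k≤n _) (word∈H _ k≤n _)
  agreeOn⇒sameCoset {i} (≤′-step {k} i≤k) k<n agree =
    resp (H i) (sym (\\-∙-cancelˡ G top-rep-equal _ _))
      (agreeOn⇒sameCoset i≤k (<⇒≤ k<n) (agreeOn-shrink agree))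
    where
    top-rep-equal = reflexive (≡.cong (rep k k<n) (agreeOn-top (≤′⇒≤ i≤k) k<n agree))

  sameCoset⇒agreeOn : ∀ {i k} → i ≤′ k → (k≤n : k ≤ n) → ∀ {d d'} →
                      SameCoset G (H i) (word k k≤n d) (word k k≤n d') → AgreeOn i k d d'
  sameCoset⇒agreeOn ≤′-refl _ _ j i≤j j<i = ⊥-elim (≤⇒≯ i≤j j<i)
  sameCoset⇒agreeOn {i} (≤′-step {k} i≤k) k<n {d} {d'} same =
    agreeOn-extend k<n top-equal (sameCoset⇒agreeOn i≤k (<⇒≤ k<n) same-tail)
    where
    top-equal : d (fromℕ< k<n) ≡ d' (fromℕ< k<n)
    top-equal = rep-injective k k<n
      (sameCoset-∙-∈ʳ G (H k) (word∈H k _ d) (word∈H k _ d') (H-mono i≤k (<⇒≤ k<n) _ same))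
    same-tail = resp (H i) (\\-∙-cancelˡ G (reflexive (≡.cong (rep k k<n) top-equal)) _ _) same

  word-cong : ∀ {k} (k≤n : k ≤ n) {d d'} → AgreeOn 0 k d d' → word k k≤n d ≈ word k k≤n d'
  word-cong k≤n = sameCoset-trivial⇒≈ G (H 0) bottom ∘ agreeOn⇒sameCoset z≤′n k≤n

  word-injective : ∀ {k} (k≤n : k ≤ n) {d d'} → word k k≤n d ≈ word k k≤n d' → AgreeOn 0 k d d'
  word-injective k≤n = sameCoset⇒agreeOn z≤′n k≤n ∘ ≈⇒sameCoset G (H 0)

  -- The digits d₀ only fill the positions ≥ k, which do not occur in the word.
  word-surjective : Digits → ∀ k (k≤n : k ≤ n) {z} → Mem (H k) z → ∃ λ d → z ≈ word k k≤n d
  word-surjective d₀ zero    _   z∈H₀ = d₀ , bottom _ z∈H₀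
  word-surjective d₀ (suc k) k<n {z} z∈H = d , z≈word
    where
    a = proj₁ (rep-covers k k<n z z∈H)
    tail = word-surjective d₀ k (<⇒≤ k<n) (proj₂ (rep-covers k k<n z z∈H))
    d = updateAt (proj₁ tail) (fromℕ< k<n) (const a)

    d-top : d (fromℕ< k<n) ≡ a
    d-top = updateAt-updates (fromℕ< k<n) (proj₁ tail)

    d-below : AgreeOn 0 k (proj₁ tail) d
    d-below j _ j<k = ≡.sym (updateAt-minimal j (fromℕ< k<n) (proj₁ tail) j≢top)
      where
      j≢top : j ≢ fromℕ< k<n
      j≢top j≡top = <-irrefl (≡.trans (≡.cong toℕ j≡top) (toℕ-fromℕ< k<n)) j<k

    z≈word : z ≈ word (suc k) k<n d
    z≈word = begin
      z                                   ≈⟨ \\-leftDividesˡ (rep k k<n a) z ⟨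
      rep k k<n a ∙ (rep k k<n a \\ z)     ≈⟨ ∙-congˡ (trans (proj₂ tail) (word-cong _ d-below)) ⟩
      rep k k<n a ∙ word k _ d            ≡⟨ ≡.cong (λ b → rep k k<n b ∙ word k _ d) (≡.sym d-top) ⟩
      word (suc k) k<n d                  ∎

  module _ (1≤n : 1 ≤ n) where

    coord : Fin m → Elem G (H 1)
    coord a = ⟨ rep 0 1≤n a , rep∈H 0 1≤n a ⟩

    coord-cong : ∀ {a b} → a ≡ b → _≈ᴱ_ G (coord a) (coord b)
    coord-cong ≡.refl = refl

    coord-injective : ∀ {a b} → _≈ᴱ_ G (coord a) (coord b) → a ≡ b
    coord-injective = rep-injective 0 1≤n ∘ ≈⇒sameCoset G (H 0)

    coord-surjective : ∀ u → ∃ λ a → _≈ᴱ_ G (coord a) u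
    coord-surjective u =
      proj₁ covers , sameCoset-trivial⇒≈ G (H 0) bottom (proj₂ covers)
      where covers = rep-covers 0 1≤n (Elem.val u) (Elem.mem u)

    -- The digits of x⁻¹, as x y⁻¹ ∈ H i says that x⁻¹ and y⁻¹ lie in the same left coset of H i.
    digits : Carrier → Digits
    digits x = proj₁ (word-surjective (const some-digit) n ≤-refl (top (x ⁻¹)))
      where some-digit = proj₁ (rep-covers 0 1≤n ε (has-ε (H 1)))

    digits-spec : ∀ x → x ⁻¹ ≈ word n ≤-refl (digits x)
    digits-spec x = proj₂ (word-surjective _ n ≤-refl (top (x ⁻¹)))

    coordinates : Carrier → Fin n → Elem G (H 1)
    coordinates x = coord ∘ digits x

    ∈H⇒agreeFrom : ∀ {i} → i ≤ n → ∀ {x y} → Mem (H i) (x ∙ y ⁻¹) →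
                   AgreeFrom (_≈ᴱ_ G) i (coordinates x) (coordinates y)
    ∈H⇒agreeFrom {i} i≤n {x} {y} x/y∈H j i≤j =
      coord-cong (agreeOn⇒agreeFrom (sameCoset⇒agreeOn (≤⇒≤′ i≤n) ≤-refl same) j i≤j)
      where
      same = sameCoset-resp G (H i) (digits-spec x) (digits-spec y)
               (resp (H i) (∙⁻¹≈⁻¹\\⁻¹ G x y) x/y∈H)

    agreeFrom⇒∈H : ∀ {i} → i ≤ n → ∀ {x y} →
                   AgreeFrom (_≈ᴱ_ G) i (coordinates x) (coordinates y) → Mem (H i) (x ∙ y ⁻¹)
    agreeFrom⇒∈H {i} i≤n {x} {y} agree =
      resp (H i) (sym (∙⁻¹≈⁻¹\\⁻¹ G x y))
        (sameCoset-resp G (H i) (sym (digits-spec x)) (sym (digits-spec y))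
          (agreeOn⇒sameCoset (≤⇒≤′ i≤n) ≤-refl
            (agreeFrom⇒agreeOn (λ j i≤j → coord-injective (agree j i≤j)))))

    chainDist⇒rtDist : ∀ {x y} i → ChainDist G n H x y i →
                       RTDist G (coordinates x) (coordinates y) i
    chainDist⇒rtDist zero x/y∈H₀ = ∈H⇒agreeFrom z≤n x/y∈H₀ , inj₁ ≡.refl
    chainDist⇒rtDist {x} {y} (suc i) (i<n , x/y∈H , x/y∉H) with fromℕ< i<n | toℕ-fromℕ< i<n
    ... | k | ≡.refl = agree , inj₂ (k , ≡.refl , differ)
      where
      agree = ∈H⇒agreeFrom i<n x/y∈H
      differ : ¬ _≈ᴱ_ G (coordinates x k) (coordinates y k)
      differ same = x/y∉H (agreeFrom⇒∈H (<⇒≤ i<n)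
        (agreeFrom-extend {_∼_ = _≈ᴱ_ G} {coordinates x} {coordinates y} k same agree))

    rtDist⇒chainDist : ∀ {x y} i → RTDist G (coordinates x) (coordinates y) i →
                       ChainDist G n H x y i
    rtDist⇒chainDist zero    (agree , _)                     = agreeFrom⇒∈H z≤n agree
    rtDist⇒chainDist (suc i) (_     , inj₁ ())
    rtDist⇒chainDist (suc _) (agree , inj₂ (k , ≡.refl , differ)) =
      toℕ<n k , agreeFrom⇒∈H (toℕ<n k) agree ,
      λ x/y∈H → differ (∈H⇒agreeFrom (<⇒≤ (toℕ<n k)) x/y∈H k ≤-refl)

    coordinates-surjective : ∀ u → ∃ λ x → _≈ⁿ_ G (coordinates x) u
    coordinates-surjective u =
      x , λ j → trans (coord-cong (digits-x j z≤n)) (proj₂ (coord-surjective (u j)))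
      where
      d = proj₁ ∘ coord-surjective ∘ u
      x = word n ≤-refl d ⁻¹
      digits-x : AgreeFrom _≡_ 0 (digits x) d
      digits-x = agreeOn⇒agreeFrom
        (word-injective ≤-refl (trans (sym (digits-spec x)) (⁻¹-involutive _)))

    coordinates-isometry : ChainRTIsometry G n H (H 1)
    coordinates-isometry = record
      { to        = coordinates
      ; to-cong   = λ x≈y j →
          ∈H⇒agreeFrom z≤n (resp (H 0) (sym (x≈y⇒x∙y⁻¹≈ε x≈y)) (has-ε (H 0))) j z≤n
      ; to-inj    = λ same → x∙y⁻¹≈ε⇒x≈y _ _ (bottom _ (agreeFrom⇒∈H z≤n (λ j _ → same j)))
      ; to-surj   = coordinates-surjective
      ; isometric = λ x y i → chainDist⇒rtDist i , rtDist⇒chainDist i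
      }

proposition7p9 : ∀ {c ℓ p : Level} (G : Group c ℓ) → IsFiniteGroup G
               → (n m : ℕ) → 1 ≤ n → (H : ℕ → Subgroup G p)
               → GeometricChain G n m H → ¬ IsTrivial G (H 1)
               → ChainRTIsometry G n H (H 1)
proposition7p9 G _ _ _ 1≤n _ chain _ = coordinates-isometry G chain 1≤n
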